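{- Let $(G,\mathcal C)$ be an edge-colored graph with conflict graph $H$ and color-intersection graph $\Gamma$. For each block $B$ of $\Gamma$ let $E(B)=\{e\in E(G): c(e)\in V(B)\}$ and $H_B=H[E(B)]$. Then $H$ can be obtained as an iterated clique-sum of the graphs $\{H_B: B\text{ a block of }\Gamma\}$, where the gluing cliques are exactly the color cliques $\{e\in E(G): c(e)=a\}$ corresponding to articulation colors $a$ of $\Gamma$.
   Context: An edge-colored graph $(G,\mathcal C)$: finite simple graph $G=(V,E)$ with a partition $\mathcal C$ of $E$ into color classes; $c(e)$ is the color of $e$. Conflict graph $H$: vertex set $E$, $e\ne f$ adjacent iff they share an endpoint or have the same color. Color-intersection graph $\Gamma$: vertex set $\mathcal C$, two distinct colors adjacent iff some edge of one color shares an endpoint with some edge of the other. Blocks are maximal 2-connected subgraphs (together with bridges and isolated vertices); articulation vertices are cut vertices. A clique-sum of two graphs glues them along a common clique $K=V(G_1)\cap V(G_2)$ with no edges between $V(G_1)\setminus K$ and $V(G_2)\setminus K$. -}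

module Defs where

open import Data.Nat using (ℕ)
open import Data.Fin using (Fin; _<_)
open import Data.Fin.Subset using (Subset; _∈_; _∉_; _⊆_)
open import Data.Product using (Σ; ∃; ∃-syntax; _×_; _,_; proj₁; proj₂)
open import Data.Sum using (_⊎_)
open import Data.Empty using (⊥)
open import Data.Unit using (⊤)
open import Relation.Nullary using (¬_)
open import Relation.Binary.PropositionalEquality using (_≡_; _≢_)
open import Function.Definitions using (Injective)

-- Colors: Fin k; col : edges → colors is surjective, so the color
-- classes {e | col e ≡ a} form a partition of E into nonempty classes.

record EdgeColoredGraph : Set where
  field
    n m k    : ℕ
    ends     : Fin m → Fin n × Fin n
    loopless : ∀ e → proj₁ (ends e) ≢ proj₂ (ends e)
    simple   : ∀ e f →
               ((proj₁ (ends e) ≡ proj₁ (ends f) × proj₂ (ends e) ≡ proj₂ (ends f))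
                ⊎ (proj₁ (ends e) ≡ proj₂ (ends f) × proj₂ (ends e) ≡ proj₁ (ends f)))
               → e ≡ f
    col      : Fin m → Fin k
    colSurj  : ∀ a → ∃[ e ] col e ≡ a

module _ (G : EdgeColoredGraph) where
  open EdgeColoredGraph G

  Incident : Fin n → Fin m → Set
  Incident v e = v ≡ proj₁ (ends e) ⊎ v ≡ proj₂ (ends e)

  ShareEnd : Fin m → Fin m → Set
  ShareEnd e f = ∃[ v ] (Incident v e × Incident v f)

  HAdj : Fin m → Fin m → Set
  HAdj e f = e ≢ f × (ShareEnd e f ⊎ col e ≡ col f)

  ΓAdj : Fin k → Fin k → Set
  ΓAdj a b = a ≢ b × ∃[ e ] ∃[ f ] (col e ≡ a × col f ≡ b × ShareEnd e f)

  data Reach (S : Fin k → Set) : Fin k → Fin k → Set where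
    here : ∀ {x} → S x → Reach S x x
    step : ∀ {x y z} → S x → ΓAdj x y → Reach S y z → Reach S x z

  -- Γ[S] is connected (the empty graph counts as connected)
  ConnectedIn : (Fin k → Set) → Set
  ConnectedIn S = ∀ x y → S x → S y → Reach S x y

  Minus : (Fin k → Set) → Fin k → Fin k → Set
  Minus S v x = S x × x ≢ v

  Nonseparable : Subset k → Set
  Nonseparable S = (∃[ x ] x ∈ S)
                 × ConnectedIn (_∈ S)
                 × (∀ v → v ∈ S → ConnectedIn (Minus (_∈ S) v))

  IsBlock : Subset k → Set
  IsBlock S = Nonseparable S × (∀ T → S ⊆ T → Nonseparable T → T ⊆ S)

  IsArticulation : Fin k → Set
  IsArticulation a = ∃[ u ] ∃[ w ] (u ≢ a × w ≢ a
                     × Reach (λ _ → ⊤) u w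
                     × ¬ Reach (Minus (λ _ → ⊤) a) u w)

  EOf : Subset k → Fin m → Set
  EOf B e = col e ∈ B

  -- Iterated clique-sum of H_{B_0}, …, H_{B_{t-1}} (in this order).
  -- After step i the graph built is H[Pre (i+1)], where Pre i is the
  -- union of E(B_j), j < i.  Step i glues H[Pre i] and H_{B_i} along
  -- Glue i = Pre i ∩ E(B_i).
  record CliqueSumDecomposition : Set where
    field
      t        : ℕ
      blocks   : Fin t → Subset k
      distinct : Injective _≡_ _≡_ blocks
      areBlocks : ∀ i → IsBlock (blocks i)
      allBlocks : ∀ B → IsBlock B → ∃[ i ] blocks i ≡ B

    Pre : Fin t → Fin m → Set
    Pre i e = ∃[ j ] (j < i × EOf (blocks j) e)

    Glue : Fin t → Fin m → Set
    Glue i e = Pre i e × EOf (blocks i) e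

    field
      glueClique : ∀ i e f → Glue i e → Glue i f → e ≢ f → HAdj e f
      noCross    : ∀ i e f → Pre i e → ¬ EOf (blocks i) e
                          → EOf (blocks i) f → ¬ Pre i f → ¬ HAdj e f
      -- each gluing clique is a color class of an articulation color
      -- (or empty, i.e. a disjoint union of components)
      glueColor  : ∀ i → (∀ e → ¬ Glue i e)
                        ⊎ (∃[ a ] (IsArticulation a
                             × (∀ e → Glue i e → col e ≡ a)
                             × (∀ e → col e ≡ a → Glue i e)))
      artUsed    : ∀ a → IsArticulation a →
                   ∃[ i ] ((∀ e → Glue i e → col e ≡ a)
                          × (∀ e → col e ≡ a → Glue i e))
      covers     : ∀ e → ∃[ i ] EOf (blocks i) e

-- The blocks of Γ can be listed so that each meets the union of the earlier ones in at most
-- one color. Greedily, always take next a block that touches the blocks already placed, if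
-- there is one; then Γ-connected placed colors stay joined by walks whose edges lie inside
-- placed blocks, and a second common color x ≠ y of a new block B would give such a walk
-- from x to y, which the maximal block B absorbs, so B would share two colors with the block
-- of the walk's first edge and coincide with it. In this order the gluing set at step i
-- consists of the edges of the single shared color a, a clique of H; a lies in two blocks
-- and is therefore an articulation color, and conversely every articulation color lies in
-- two blocks and is glued at the later one. Edges adjacent in H have their colors in a
-- common block, which rules out H-edges across a gluing.

module Submission where

open import Defs
open import Data.Nat as ℕ using (ℕ; zero; suc; _≤_; s≤s)
open import Data.Nat.Properties as ℕ using (≤-trans)
open import Data.Bool.Properties using () renaming (_≟_ to _≟ᵇ_)
open import Data.Fin as Fin using (Fin; _<_)
open import Data.Fin.Properties as Fin using (_≟_; any?; all?; injective⇒≤)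
open import Data.Fin.Subset
  using (Subset; _∈_; _∉_; _⊆_; _⊂_; _⊃_; _∪_; ⁅_⁆; inside; outside)
open import Data.Fin.Subset.Properties
  using (_∈?_; _⊂?_; ⊆-antisym; anySubset?; x∈⁅x⁆; x∈⁅y⁆⇒x≡y; x∈p∪q⁺; x∈p∪q⁻; p⊆p∪q; q⊆p∪q)
open import Data.Fin.Subset.Induction using (Acc; acc; ⊃-wellFounded)
open import Data.Vec using ([]; _∷_)
open import Data.Vec.Properties using (≡-dec)
open import Data.List as List using (List; []; _∷_; [_]; _++_; map; filter; length)
open import Data.List.Properties using (filter-notAll)
open import Data.List.Relation.Unary.Any as Any using (Any; here; there)
open import Data.List.Relation.Unary.Any.Properties using (lookup-index)
open import Data.List.Relation.Unary.All as All using (All)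
open import Data.List.Relation.Unary.Unique.Propositional using (Unique)
open import Data.List.Relation.Unary.AllPairs using ([]; _∷_)
open import Data.List.Membership.Propositional using (find) renaming (_∈_ to _∈ₗ_; _∉_ to _∉ₗ_)
open import Data.List.Membership.Propositional.Properties
  using (∈-lookup; ∈-map⁺; ∈-++⁺ˡ; ∈-++⁺ʳ; ∈-filter⁺; ∈-filter⁻)
open import Data.Product using (Σ; ∃-syntax; _×_; _,_; proj₁; proj₂; swap)
open import Data.Sum as Sum using (_⊎_; inj₁; inj₂)
open import Data.Empty using (⊥-elim)
open import Data.Unit using (⊤; tt)
open import Function using (_∘_; id)
open import Relation.Nullary using (¬_; Dec; yes; no)
open import Relation.Nullary.Decidable using (_×-dec_; _⊎-dec_; _→-dec_; ¬?; map′)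
open import Relation.Binary.Definitions using (tri<; tri≈; tri>)
open import Relation.Binary.PropositionalEquality using (_≡_; _≢_; refl; sym; trans; cong; subst)
open import Relation.Binary.Construct.Closure.ReflexiveTransitive as Star using (Star; ε; _◅_; _◅◅_)

lookup-injective : {A : Set} {xs : List A} → Unique xs →
                   ∀ i j → List.lookup xs i ≡ List.lookup xs j → i ≡ j
lookup-injective (_  ∷ _) Fin.zero    Fin.zero    _  = refl
lookup-injective (x∉ ∷ _) Fin.zero    (Fin.suc j) eq = ⊥-elim (All.lookup x∉ (∈-lookup j) eq)
lookup-injective (x∉ ∷ _) (Fin.suc i) Fin.zero    eq = ⊥-elim (All.lookup x∉ (∈-lookup i) (sym eq))
lookup-injective (_  ∷ u) (Fin.suc i) (Fin.suc j) eq = cong Fin.suc (lookup-injective u i j eq)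

allSubsets : (k : ℕ) → List (Subset k)
allSubsets zero    = [ [] ]
allSubsets (suc k) = map (inside ∷_) (allSubsets k) ++ map (outside ∷_) (allSubsets k)

∈-allSubsets : ∀ {k} (S : Subset k) → S ∈ₗ allSubsets k
∈-allSubsets []            = here refl
∈-allSubsets (inside  ∷ S) = ∈-++⁺ˡ (∈-map⁺ (inside ∷_) (∈-allSubsets S))
∈-allSubsets {suc k} (outside ∷ S) =
  ∈-++⁺ʳ (map (inside ∷_) (allSubsets k)) (∈-map⁺ (outside ∷_) (∈-allSubsets S))

module Walks {k : ℕ} {E : Fin k → Fin k → Set} where

  vertices : ∀ {x y} → Star E x y → Subset k
  vertices {x} ε       = ⁅ x ⁆
  vertices {x} (_ ◅ w) = ⁅ x ⁆ ∪ vertices w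

  source∈vertices : ∀ {x y} (w : Star E x y) → x ∈ vertices w
  source∈vertices {x} ε       = x∈⁅x⁆ x
  source∈vertices {x} (_ ◅ w) = x∈p∪q⁺ (inj₁ (x∈⁅x⁆ x))

  target∈vertices : ∀ {x y} (w : Star E x y) → y ∈ vertices w
  target∈vertices ε       = source∈vertices ε
  target∈vertices (_ ◅ w) = x∈p∪q⁺ (inj₂ (target∈vertices w))

  Simple : ∀ {x y} → Star E x y → Set
  Simple ε           = ⊤
  Simple {x} (_ ◅ w) = x ∉ vertices w × Simple w

  suffixFrom : ∀ {x y z} (w : Star E x z) → Simple w → y ∈ vertices w → Σ (Star E y z) Simple
  suffixFrom {x} ε _ y∈w with refl ← x∈⁅y⁆⇒x≡y x y∈w = ε , tt
  suffixFrom {x} (e ◅ w) (x∉w , s) y∈ with x∈p∪q⁻ ⁅ x ⁆ (vertices w) y∈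
  ... | inj₁ y∈⁅x⁆ with refl ← x∈⁅y⁆⇒x≡y x y∈⁅x⁆ = e ◅ w , x∉w , s
  ... | inj₂ y∈w = suffixFrom w s y∈w

  toSimple : ∀ {x y} → Star E x y → Σ (Star E x y) Simple
  toSimple ε = ε , tt
  toSimple {x} (e ◅ w) with toSimple w
  ... | w′ , s′ with x ∈? vertices w′
  ...   | yes x∈w′ = suffixFrom w′ s′ x∈w′
  ...   | no  x∉w′ = e ◅ w′ , x∉w′ , s′

  steps : ∀ {x y} → Star E x y → ℕ
  steps ε       = 0
  steps (_ ◅ w) = suc (steps w)

  vertexAt : ∀ {x y} (w : Star E x y) → Fin (suc (steps w)) → Fin k
  vertexAt {x} w       Fin.zero    = x
  vertexAt     (_ ◅ w) (Fin.suc i) = vertexAt w i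

  vertexAt∈vertices : ∀ {x y} (w : Star E x y) i → vertexAt w i ∈ vertices w
  vertexAt∈vertices w       Fin.zero    = source∈vertices w
  vertexAt∈vertices (_ ◅ w) (Fin.suc i) = x∈p∪q⁺ (inj₂ (vertexAt∈vertices w i))

  vertexAt-injective : ∀ {x y} (w : Star E x y) → Simple w →
                       ∀ i j → vertexAt w i ≡ vertexAt w j → i ≡ j
  vertexAt-injective ε       _         Fin.zero    Fin.zero    _  = refl
  vertexAt-injective (_ ◅ w) _         Fin.zero    Fin.zero    _  = refl
  vertexAt-injective (_ ◅ w) (x∉w , _) Fin.zero    (Fin.suc j) eq =
    ⊥-elim (x∉w (subst (_∈ vertices w) (sym eq) (vertexAt∈vertices w j)))
  vertexAt-injective (_ ◅ w) (x∉w , _) (Fin.suc i) Fin.zero    eq =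
    ⊥-elim (x∉w (subst (_∈ vertices w) eq (vertexAt∈vertices w i)))
  vertexAt-injective (_ ◅ w) (_ , s)   (Fin.suc i) (Fin.suc j) eq =
    cong Fin.suc (vertexAt-injective w s i j eq)

  simple⇒steps< : ∀ {x y} (w : Star E x y) → Simple w → steps w ℕ.< k
  simple⇒steps< w s = injective⇒≤ (λ {i j} → vertexAt-injective w s i j)

module BlockTheory (G : EdgeColoredGraph) where
  open EdgeColoredGraph G
  open Walks

  private
    variable
      S T U : Fin k → Set
      x y z : Fin k

  -- Reachability in Γ

  Γ : Fin k → Fin k → Set
  Γ = ΓAdj G

  Γ-sym : Γ x y → Γ y x
  Γ-sym (x≢y , e , f , ce , cf , v , ve , vf) = x≢y ∘ sym , f , e , cf , ce , v , vf , ve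

  Γ-irrefl : Γ x y → x ≢ y
  Γ-irrefl = proj₁

  Γ? : ∀ x y → Dec (Γ x y)
  Γ? x y = ¬? (x ≟ y) ×-dec any? λ e → any? λ f → (col e ≟ x) ×-dec (col f ≟ y) ×-dec shareEnd? e f
    where
    incident? : ∀ v e → Dec (Incident G v e)
    incident? v e = (v ≟ proj₁ (ends e)) ⊎-dec (v ≟ proj₂ (ends e))
    shareEnd? : ∀ e f → Dec (ShareEnd G e f)
    shareEnd? e f = any? λ v → incident? v e ×-dec incident? v f

  reach-source : Reach G S x y → S x
  reach-source (here s)     = s
  reach-source (step s _ _) = s

  reach-target : Reach G S x y → S y
  reach-target (here s)     = s
  reach-target (step _ _ r) = reach-target r

  reach-mono : (∀ {z} → S z → T z) → Reach G S x y → Reach G T x y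
  reach-mono f (here s)     = here (f s)
  reach-mono f (step s a r) = step (f s) a (reach-mono f r)

  infixr 5 _++ʳ_
  _++ʳ_ : Reach G S x y → Reach G S y z → Reach G S x z
  here _     ++ʳ r′ = r′
  step s a r ++ʳ r′ = step s a (r ++ʳ r′)

  reach-sym : Reach G S x y → Reach G S y x
  reach-sym (here s)     = here s
  reach-sym (step s a r) = reach-sym r ++ʳ step (reach-source r) (Γ-sym a) (here s)

  Γ[_] : (Fin k → Set) → Fin k → Fin k → Set
  Γ[ S ] x y = S x × Γ x y × S y

  reach⇒walk : Reach G S x y → Star Γ[ S ] x y
  reach⇒walk (here _)     = ε
  reach⇒walk (step s a r) = (s , a , reach-source r) ◅ reach⇒walk r

  Γ[]-vertices-within : S x → (w : Star Γ[ S ] x y) → z ∈ vertices w → S z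
  Γ[]-vertices-within {x = x} s ε z∈ with refl ← x∈⁅y⁆⇒x≡y x z∈ = s
  Γ[]-vertices-within {x = x} s ((_ , _ , s′) ◅ w) z∈ with x∈p∪q⁻ ⁅ x ⁆ (vertices w) z∈
  ... | inj₁ z∈⁅x⁆ with refl ← x∈⁅y⁆⇒x≡y x z∈⁅x⁆ = s
  ... | inj₂ z∈w = Γ[]-vertices-within s′ w z∈w

  BoundedReach : (Fin k → Set) → ℕ → Fin k → Fin k → Set
  BoundedReach S zero    x y = S x × x ≡ y
  BoundedReach S (suc n) x y = BoundedReach S zero x y ⊎ ∃[ z ] Γ[ S ] x z × BoundedReach S n z y

  boundedReach⇒reach : ∀ n → BoundedReach S n x y → Reach G S x y
  boundedReach⇒reach zero    (s , refl)                 = here s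
  boundedReach⇒reach (suc n) (inj₁ (s , refl))          = here s
  boundedReach⇒reach (suc n) (inj₂ (_ , (s , a , _) , r)) = step s a (boundedReach⇒reach n r)

  walk⇒boundedReach : ∀ {n} → S x → (w : Star Γ[ S ] x y) → steps w ≤ n → BoundedReach S n x y
  walk⇒boundedReach {n = zero}  s ε _ = s , refl
  walk⇒boundedReach {n = suc n} s ε _ = inj₁ (s , refl)
  walk⇒boundedReach {n = suc n} s (e@(_ , _ , s′) ◅ w) (s≤s l) = inj₂ (_ , e , walk⇒boundedReach s′ w l)

  boundedReach? : (∀ x → Dec (S x)) → ∀ n x y → Dec (BoundedReach S n x y)
  boundedReach? S? zero    x y = S? x ×-dec (x ≟ y)
  boundedReach? S? (suc n) x y =
    boundedReach? S? zero x y ⊎-dec any? λ z → (S? x ×-dec Γ? x z ×-dec S? z) ×-dec boundedReach? S? n z y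

  -- Walks of at most k steps suffice, since a simple walk has fewer.
  reach? : (∀ x → Dec (S x)) → ∀ x y → Dec (Reach G S x y)
  reach? {S} S? x y = map′ (boundedReach⇒reach k) shorten (boundedReach? S? k x y)
    where
    shorten : Reach G S x y → BoundedReach S k x y
    shorten r with w , s ← toSimple (reach⇒walk r) =
      walk⇒boundedReach (reach-source r) w (ℕ.<⇒≤ (simple⇒steps< w s))

  connectedIn? : (∀ x → Dec (S x)) → Dec (ConnectedIn G S)
  connectedIn? S? = all? λ x → all? λ y → S? x →-dec S? y →-dec reach? S? x y

  -- Deciding blocks

  nonseparable? : ∀ B → Dec (Nonseparable G B)
  nonseparable? B =
    any? (_∈? B) ×-dec connectedIn? (_∈? B) ×-dec
    all? λ v → (v ∈? B) →-dec connectedIn? λ x → (x ∈? B) ×-dec ¬? (x ≟ v)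

  ProperNonseparableSuperset : Subset k → Set
  ProperNonseparableSuperset B = ∃[ C ] (B ⊂ C × Nonseparable G C)

  properNonseparableSuperset? : ∀ B → Dec (ProperNonseparableSuperset B)
  properNonseparableSuperset? B = anySubset? λ C → (B ⊂? C) ×-dec nonseparable? C

  noProper⇒maximal : ∀ {B} → ¬ ProperNonseparableSuperset B →
                     ∀ C → B ⊆ C → Nonseparable G C → C ⊆ B
  noProper⇒maximal {B} none C B⊆C nC {x} x∈C with x ∈? B
  ... | yes x∈B = x∈B
  ... | no  x∉B = ⊥-elim (none (C , (B⊆C , x , x∈C , x∉B) , nC))

  isBlock? : ∀ B → Dec (IsBlock G B)
  isBlock? B =
    nonseparable? B ×-dec map′ noProper⇒maximal maximal⇒noProper (¬? (properNonseparableSuperset? B))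
    where
    maximal⇒noProper : (∀ C → B ⊆ C → Nonseparable G C → C ⊆ B) → ¬ ProperNonseparableSuperset B
    maximal⇒noProper max (C , (B⊆C , x , x∈C , x∉B) , nC) = x∉B (max C B⊆C nC x∈C)

  extend-to-block : ∀ {B} → Nonseparable G B → ∃[ C ] IsBlock G C × B ⊆ C
  extend-to-block = go (⊃-wellFounded _)
    where
    go : ∀ {B} → Acc _⊃_ B → Nonseparable G B → ∃[ C ] IsBlock G C × B ⊆ C
    go {B} (acc larger) nB with properNonseparableSuperset? B
    ... | yes (C , B⊂C , nC) with D , bD , C⊆D ← go (larger B⊂C) nC = D , bD , C⊆D ∘ proj₁ B⊂C
    ... | no none = B , (nB , noProper⇒maximal none) , id

  -- Nonseparable unions

  minus-⊆ : ∀ {B C v} → B ⊆ C → Minus G (_∈ B) v z → Minus G (_∈ C) v z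
  minus-⊆ B⊆C (z∈B , z≢v) = B⊆C z∈B , z≢v

  connected : ∀ {B} → Nonseparable G B → ConnectedIn G (_∈ B)
  connected = proj₁ ∘ proj₂

  connected-minus : ∀ {B} → Nonseparable G B → ∀ v → ConnectedIn G (Minus G (_∈ B) v)
  connected-minus {B} nB v with v ∈? B
  ... | yes v∈B = proj₂ (proj₂ nB) v v∈B
  ... | no  v∉B = λ x y x∈ y∈ →
    reach-mono (λ z∈B → z∈B , λ { refl → v∉B z∈B }) (connected nB x y (proj₁ x∈) (proj₁ y∈))

  Anchored : (T S : Fin k → Set) → Set
  Anchored T S = ∀ {z} → T z → ∃[ s ] S s × Reach G T z s

  anchored-∪ : (∀ {z} → U z → S z ⊎ T z) → (∀ {z} → T z → U z) → Anchored T S → Anchored U S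
  anchored-∪ split T⊆U anchoredT uz with split uz
  ... | inj₁ sz = _ , sz , here uz
  ... | inj₂ tz with s , ss , z→s ← anchoredT tz = s , ss , reach-mono T⊆U z→s

  connected-core : ConnectedIn G S → (∀ {z} → S z → T z) → Anchored T S → ConnectedIn G T
  connected-core cS S⊆T anchored x y tx ty
    with c , sc , x→c ← anchored tx | d , sd , y→d ← anchored ty =
    x→c ++ʳ reach-mono S⊆T (cS c d sc sd) ++ʳ reach-sym y→d

  nonseparable-attach : ∀ {B C} → Nonseparable G B → Anchored (_∈ C) (_∈ B) →
                        (∀ v → Anchored (Minus G (_∈ C) v) (Minus G (_∈ B) v)) → Nonseparable G (B ∪ C)
  nonseparable-attach {B} {C} nB@((b , b∈B) , _) C→B C→B-minus =
    (b , p⊆p∪q C b∈B) ,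
    connected-core (connected nB) (p⊆p∪q C) (anchored-∪ (x∈p∪q⁻ B C) (q⊆p∪q B C) C→B) ,
    λ v _ → connected-core (connected-minus nB v) (minus-⊆ (p⊆p∪q C))
              (anchored-∪ (split-minus v) (minus-⊆ (q⊆p∪q B C)) (C→B-minus v))
    where
    split-minus : ∀ v {z} → Minus G (_∈ B ∪ C) v z → Minus G (_∈ B) v z ⊎ Minus G (_∈ C) v z
    split-minus v (z∈ , z≢v) = Sum.map (_, z≢v) (_, z≢v) (x∈p∪q⁻ B C z∈)

  nonseparable-∪ : ∀ {B C} → Nonseparable G B → Nonseparable G C →
                   x ∈ B → x ∈ C → y ∈ B → y ∈ C → x ≢ y → Nonseparable G (B ∪ C)
  nonseparable-∪ {x = x} {y = y} {B} {C} nB nC x∈B x∈C y∈B y∈C x≢y =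
    nonseparable-attach nB (λ z∈C → x , x∈B , connected nC _ x z∈C x∈C) C→B-minus
    where
    C→B-minus : ∀ v → Anchored (Minus G (_∈ C) v) (Minus G (_∈ B) v)
    C→B-minus v z∉ with x ≟ v
    ... | no  x≢v  = x , (x∈B , x≢v) , connected-minus nC v _ x z∉ (x∈C , x≢v)
    ... | yes refl = y , (y∈B , x≢y ∘ sym) , connected-minus nC v _ y z∉ (y∈C , x≢y ∘ sym)

  module _ {E : Fin k → Fin k → Set} (toΓ : ∀ {x y} → E x y → Γ x y) where

    walk-reach-target : (w : Star E x y) → z ∈ vertices w → Reach G (_∈ vertices w) z y
    walk-reach-target {x} ε z∈ with refl ← x∈⁅y⁆⇒x≡y x z∈ = here z∈
    walk-reach-target {x} (e ◅ w) z∈ with x∈p∪q⁻ ⁅ x ⁆ (vertices w) z∈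
    ... | inj₁ z∈⁅x⁆ with refl ← x∈⁅y⁆⇒x≡y x z∈⁅x⁆ =
      step z∈ (toΓ e) (reach-mono (q⊆p∪q _ _) (walk-reach-target w (source∈vertices w)))
    ... | inj₂ z∈w = reach-mono (q⊆p∪q _ _) (walk-reach-target w z∈w)

    walk-reach-source : (w : Star E x y) → z ∈ vertices w → Reach G (_∈ vertices w) z x
    walk-reach-source w z∈ = walk-reach-target w z∈ ++ʳ reach-sym (walk-reach-target w (source∈vertices w))

    simple-walk-minus-reaches-end : (w : Star E x y) → Simple w → ∀ v → z ∈ vertices w → z ≢ v →
      Reach G (Minus G (_∈ vertices w) v) z x ⊎ Reach G (Minus G (_∈ vertices w) v) z y
    simple-walk-minus-reaches-end {x} ε _ v z∈ z≢v with refl ← x∈⁅y⁆⇒x≡y x z∈ = inj₁ (here (z∈ , z≢v))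
    simple-walk-minus-reaches-end {x} (e ◅ w) (x∉w , s) v z∈ z≢v with x∈p∪q⁻ ⁅ x ⁆ (vertices w) z∈
    ... | inj₁ z∈⁅x⁆ with refl ← x∈⁅y⁆⇒x≡y x z∈⁅x⁆ = inj₁ (here (z∈ , z≢v))
    ... | inj₂ z∈w with simple-walk-minus-reaches-end w s v z∈w z≢v
    ...   | inj₂ z→y = inj₂ (reach-mono (minus-⊆ (q⊆p∪q ⁅ x ⁆ (vertices w))) z→y)
    ...   | inj₁ z→x′ with x ≟ v
    ...     | no x≢v = inj₁ (reach-mono (minus-⊆ (q⊆p∪q ⁅ x ⁆ (vertices w))) z→x′ ++ʳ
                         step (minus-⊆ (q⊆p∪q ⁅ x ⁆ (vertices w)) (reach-target z→x′)) (Γ-sym (toΓ e))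
                              (here (source∈vertices (e ◅ w) , x≢v)))
    -- v is the first vertex, which a simple walk never revisits.
    ...     | yes refl = inj₂ (reach-mono (λ u∈w → q⊆p∪q ⁅ x ⁆ (vertices w) u∈w , λ { refl → x∉w u∈w })
                                          (walk-reach-target w z∈w))

    nonseparable-∪-walk : ∀ {B} → Nonseparable G B → (w : Star E x y) → Simple w →
                          x ∈ B → y ∈ B → Nonseparable G (B ∪ vertices w)
    nonseparable-∪-walk {x = x} {y = y} {B} nB w s x∈B y∈B =
      nonseparable-attach nB (λ z∈w → y , y∈B , walk-reach-target w z∈w) w→B-minus
      where
      w→B-minus : ∀ v → Anchored (Minus G (_∈ vertices w) v) (Minus G (_∈ B) v)
      w→B-minus v (z∈w , z≢v) with simple-walk-minus-reaches-end w s v z∈w z≢v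
      ... | inj₁ z→x = x , (x∈B , proj₂ (reach-target z→x)) , z→x
      ... | inj₂ z→y = y , (y∈B , proj₂ (reach-target z→y)) , z→y

    nonseparable-∪-∪-walk :
      ∀ {B₁ B₂ a u u′} → Nonseparable G B₁ → Nonseparable G B₂ → a ∈ B₁ → a ∈ B₂ →
      (w : Star E u u′) → Simple w → u ∈ B₁ → u′ ∈ B₂ → u ≢ a → u′ ≢ a → a ∉ vertices w →
      Nonseparable G (B₁ ∪ B₂ ∪ vertices w)
    nonseparable-∪-∪-walk {B₁} {B₂} {a} {u} {u′} n₁ n₂ a∈₁ a∈₂ w s u∈₁ u′∈₂ u≢a u′≢a a∉w =
      nonseparable-attach n₁ C→B₁ C→B₁-minus
      where
      C : Subset k
      C = B₂ ∪ vertices w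
      B₂⊆ : B₂ ⊆ C
      B₂⊆ = p⊆p∪q (vertices w)
      W⊆ : vertices w ⊆ C
      W⊆ = q⊆p∪q B₂ (vertices w)
      C→B₁ : Anchored (_∈ C) (_∈ B₁)
      C→B₁ z∈ with x∈p∪q⁻ B₂ (vertices w) z∈
      ... | inj₁ z∈₂ = a , a∈₁ , reach-mono B₂⊆ (connected n₂ _ a z∈₂ a∈₂)
      ... | inj₂ z∈w = u , u∈₁ , reach-mono W⊆ (walk-reach-source w z∈w)
      walk-to-u : z ∈ vertices w → Reach G (Minus G (_∈ C) a) z u
      walk-to-u z∈w = reach-mono (λ y∈w → W⊆ y∈w , λ { refl → a∉w y∈w }) (walk-reach-source w z∈w)
      B₂-minus : ∀ v → Minus G (_∈ B₂) v z → Minus G (_∈ B₂) v y → Reach G (Minus G (_∈ C) v) z y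
      B₂-minus v z∉ y∉ = reach-mono (minus-⊆ B₂⊆) (connected-minus n₂ v _ _ z∉ y∉)
      C→B₁-minus : ∀ v → Anchored (Minus G (_∈ C) v) (Minus G (_∈ B₁) v)
      C→B₁-minus v (z∈ , z≢v) with a ≟ v | x∈p∪q⁻ B₂ (vertices w) z∈
      ... | yes refl | inj₁ z∈₂ =
        u , (u∈₁ , u≢a) , B₂-minus _ (z∈₂ , z≢v) (u′∈₂ , u′≢a) ++ʳ walk-to-u (target∈vertices w)
      ... | yes refl | inj₂ z∈w = u , (u∈₁ , u≢a) , walk-to-u z∈w
      ... | no  a≢v  | inj₁ z∈₂ = a , (a∈₁ , a≢v) , B₂-minus v (z∈₂ , z≢v) (a∈₂ , a≢v)
      ... | no  a≢v  | inj₂ z∈w with simple-walk-minus-reaches-end w s v z∈w z≢v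
      ...   | inj₁ z→u  = u , (u∈₁ , proj₂ (reach-target z→u)) , reach-mono (minus-⊆ W⊆) z→u
      ...   | inj₂ z→u′ = a , (a∈₁ , a≢v) ,
        reach-mono (minus-⊆ W⊆) z→u′ ++ʳ B₂-minus v (u′∈₂ , proj₂ (reach-target z→u′)) (a∈₂ , a≢v)

  -- Blocks and articulation colors

  subsingleton-connected : (∀ {a b} → S a → S b → a ≡ b) → ConnectedIn G S
  subsingleton-connected unique a b sa sb with refl ← unique sa sb = here sa

  nonseparable-⁅⁆ : ∀ x → Nonseparable G ⁅ x ⁆
  nonseparable-⁅⁆ x =
    (x , x∈⁅x⁆ x) , subsingleton-connected same ,
    λ _ _ → subsingleton-connected λ a b → same (proj₁ a) (proj₁ b)
    where
    same : ∀ {a b} → a ∈ ⁅ x ⁆ → b ∈ ⁅ x ⁆ → a ≡ b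
    same a∈ b∈ = trans (x∈⁅y⁆⇒x≡y x a∈) (sym (x∈⁅y⁆⇒x≡y x b∈))

  nonseparable-edge : Γ x y → Nonseparable G (⁅ x ⁆ ∪ ⁅ y ⁆)
  nonseparable-edge {x} {y} x~y = (x , x∈) , (λ a b a∈ b∈ → to-x a∈ ++ʳ reach-sym (to-x b∈)) ,
    λ v v∈ → subsingleton-connected (same-minus v∈)
    where
    x∈ : x ∈ ⁅ x ⁆ ∪ ⁅ y ⁆
    x∈ = x∈p∪q⁺ (inj₁ (x∈⁅x⁆ x))
    y∈ : y ∈ ⁅ x ⁆ ∪ ⁅ y ⁆
    y∈ = x∈p∪q⁺ (inj₂ (x∈⁅x⁆ y))
    x-or-y : z ∈ ⁅ x ⁆ ∪ ⁅ y ⁆ → z ≡ x ⊎ z ≡ y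
    x-or-y z∈ with x∈p∪q⁻ ⁅ x ⁆ ⁅ y ⁆ z∈
    ... | inj₁ z∈⁅x⁆ = inj₁ (x∈⁅y⁆⇒x≡y x z∈⁅x⁆)
    ... | inj₂ z∈⁅y⁆ = inj₂ (x∈⁅y⁆⇒x≡y y z∈⁅y⁆)
    to-x : z ∈ ⁅ x ⁆ ∪ ⁅ y ⁆ → Reach G (_∈ ⁅ x ⁆ ∪ ⁅ y ⁆) z x
    to-x z∈ with x-or-y z∈
    ... | inj₁ refl = here x∈
    ... | inj₂ refl = step y∈ (Γ-sym x~y) (here x∈)
    same-minus : ∀ {v a b} → v ∈ ⁅ x ⁆ ∪ ⁅ y ⁆ →
                 Minus G (_∈ ⁅ x ⁆ ∪ ⁅ y ⁆) v a → Minus G (_∈ ⁅ x ⁆ ∪ ⁅ y ⁆) v b → a ≡ b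
    same-minus v∈ (a∈ , a≢v) (b∈ , b≢v) with x-or-y a∈ | x-or-y b∈ | x-or-y v∈
    ... | inj₁ refl | inj₁ refl | _         = refl
    ... | inj₂ refl | inj₂ refl | _         = refl
    ... | inj₁ refl | inj₂ refl | inj₁ refl = ⊥-elim (a≢v refl)
    ... | inj₁ refl | inj₂ refl | inj₂ refl = ⊥-elim (b≢v refl)
    ... | inj₂ refl | inj₁ refl | inj₁ refl = ⊥-elim (b≢v refl)
    ... | inj₂ refl | inj₁ refl | inj₂ refl = ⊥-elim (a≢v refl)

  block-containing : ∀ x → ∃[ B ] IsBlock G B × x ∈ B
  block-containing x with B , bB , ⁅x⁆⊆B ← extend-to-block (nonseparable-⁅⁆ x) = B , bB , ⁅x⁆⊆B (x∈⁅x⁆ x)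

  block-containing-edge : Γ x y → ∃[ B ] IsBlock G B × x ∈ B × y ∈ B
  block-containing-edge {x} {y} x~y with B , bB , e⊆B ← extend-to-block (nonseparable-edge x~y) =
    B , bB , e⊆B (x∈p∪q⁺ (inj₁ (x∈⁅x⁆ x))) , e⊆B (x∈p∪q⁺ (inj₂ (x∈⁅x⁆ y)))

  blocks-sharing-two-≡ : ∀ {B C} → IsBlock G B → IsBlock G C →
                         x ∈ B → x ∈ C → y ∈ B → y ∈ C → x ≢ y → B ≡ C
  blocks-sharing-two-≡ {B = B} {C} (nB , maxB) (nC , maxC) x∈B x∈C y∈B y∈C x≢y =
    ⊆-antisym (maxC _ (q⊆p∪q B C) B∪C ∘ p⊆p∪q C) (maxB _ (p⊆p∪q C) B∪C ∘ q⊆p∪q B C)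
    where B∪C = nonseparable-∪ nB nC x∈B x∈C y∈B y∈C x≢y

  block-⊆⇒≡ : ∀ {B C} → IsBlock G B → IsBlock G C → B ⊆ C → B ≡ C
  block-⊆⇒≡ (_ , maxB) (nC , _) B⊆C = ⊆-antisym B⊆C (maxB _ B⊆C nC)

  shared⇒other-vertex : ∀ {B C a} → IsBlock G B → IsBlock G C → a ∈ B → a ∈ C → B ≢ C →
                        ∃[ u ] u ∈ B × u ≢ a
  shared⇒other-vertex {B} {C} {a} bB bC a∈B a∈C B≢C with any? (λ u → (u ∈? B) ×-dec ¬? (u ≟ a))
  ... | yes found = found
  ... | no  none  = ⊥-elim (B≢C (block-⊆⇒≡ bB bC B⊆C))
    where
    B⊆C : B ⊆ C
    B⊆C {u} u∈B with u ≟ a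
    ... | yes refl = a∈C
    ... | no  u≢a  = ⊥-elim (none (u , u∈B , u≢a))

  shared⇒articulation : ∀ {B₁ B₂ a} → IsBlock G B₁ → IsBlock G B₂ → a ∈ B₁ → a ∈ B₂ → B₁ ≢ B₂ →
                        IsArticulation G a
  shared⇒articulation {B₁} {B₂} {a} b₁@(n₁ , max₁) b₂@(n₂ , _) a∈₁ a∈₂ B₁≢B₂
    with u , u∈₁ , u≢a ← shared⇒other-vertex b₁ b₂ a∈₁ a∈₂ B₁≢B₂
       | w , w∈₂ , w≢a ← shared⇒other-vertex b₂ b₁ a∈₂ a∈₁ (B₁≢B₂ ∘ sym) =
    u , w , u≢a , w≢a ,
    reach-mono (λ _ → tt) (connected n₁ u a u∈₁ a∈₁) ++ʳ reach-mono (λ _ → tt) (connected n₂ a w a∈₂ w∈₂) ,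
    no-detour
    where
    no-detour : ¬ Reach G (Minus G (λ _ → ⊤) a) u w
    no-detour u→w with p , simple ← toSimple (reach⇒walk u→w) =
      B₁≢B₂ (sym (block-⊆⇒≡ b₂ b₁ (U⊆B₁ ∘ q⊆p∪q B₁ _ ∘ p⊆p∪q (vertices p))))
      where
      a∉p : a ∉ vertices p
      a∉p a∈p = proj₂ (Γ[]-vertices-within (tt , u≢a) p a∈p) refl
      U⊆B₁ : B₁ ∪ B₂ ∪ vertices p ⊆ B₁
      U⊆B₁ = max₁ _ (p⊆p∪q _)
        (nonseparable-∪-∪-walk (proj₁ ∘ proj₂) n₁ n₂ a∈₁ a∈₂ p simple u∈₁ w∈₂ u≢a w≢a a∉p)

  first-entry : ∀ {a u w} → Reach G (λ _ → ⊤) u w → u ≢ a → ¬ Reach G (Minus G (λ _ → ⊤) a) u w →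
                ∃[ p ] Reach G (Minus G (λ _ → ⊤) a) u p × Γ p a × Reach G (λ _ → ⊤) a w
  first-entry (here _) u≢a avoid = ⊥-elim (avoid (here (tt , u≢a)))
  first-entry {a} (step {y = y} _ u~y y→w) u≢a avoid with y ≟ a
  ... | yes refl = _ , here (tt , u≢a) , u~y , y→w
  ... | no  y≢a with p , y→p , p~a , a→w ← first-entry y→w y≢a (avoid ∘ step (tt , u≢a) u~y) =
    p , step (tt , u≢a) u~y y→p , p~a , a→w

  articulation⇒shared : ∀ {a} → IsArticulation G a →
                        ∃[ B₁ ] ∃[ B₂ ] IsBlock G B₁ × IsBlock G B₂ × a ∈ B₁ × a ∈ B₂ × B₁ ≢ B₂
  articulation⇒shared {a} (u , w , u≢a , w≢a , u→w , avoid)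
    with p , u→p , p~a , a→w ← first-entry u→w u≢a avoid
    with q , w→q , q~a , _ ← first-entry (reach-sym a→w) w≢a (λ w→a → proj₂ (reach-target w→a) refl)
    with B₁ , b₁ , p∈₁ , a∈₁ ← block-containing-edge p~a
       | B₂ , b₂ , q∈₂ , a∈₂ ← block-containing-edge q~a =
    B₁ , B₂ , b₁ , b₂ , a∈₁ , a∈₂ , distinct
    where
    distinct : B₁ ≢ B₂
    distinct refl = avoid (u→p ++ʳ p→q ++ʳ reach-sym w→q)
      where
      p→q : Reach G (Minus G (λ _ → ⊤) a) p q
      p→q = reach-mono (λ (_ , z≢a) → tt , z≢a)
              (connected-minus (proj₁ b₁) a p q (p∈₁ , Γ-irrefl p~a) (q∈₂ , Γ-irrefl q~a))

  -- Ordering the blocks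

  _∈⋃_ : Fin k → List (Subset k) → Set
  x ∈⋃ Bs = Any (x ∈_) Bs

  BlockEdge : List (Subset k) → Fin k → Fin k → Set
  BlockEdge Bs x y = Γ x y × Any (λ B → x ∈ B × y ∈ B) Bs

  Linked : List (Subset k) → Set
  Linked Bs = ∀ {x y} → x ∈⋃ Bs → y ∈⋃ Bs → Reach G (λ _ → ⊤) x y → Star (BlockEdge Bs) x y

  MeetsAtMostOnce : List (Subset k) → Subset k → Set
  MeetsAtMostOnce Bs B = ∀ {x y} → x ∈ B → y ∈ B → x ∈⋃ Bs → y ∈⋃ Bs → x ≡ y

  Ordered : List (Subset k) → List (Subset k) → Set
  Ordered Bs []       = ⊤
  Ordered Bs (C ∷ Cs) = MeetsAtMostOnce Bs C × Ordered (C ∷ Bs) Cs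

  fresh-block-meetsAtMostOnce : ∀ {B Bs} → IsBlock G B → B ∉ₗ Bs → (∀ {C} → C ∈ₗ Bs → IsBlock G C) →
                                Linked Bs → MeetsAtMostOnce Bs B
  fresh-block-meetsAtMostOnce {B} {Bs} bB@(nB , maxB) B∉Bs blocks linked {x} {y} x∈B y∈B x∈⋃ y∈⋃ with x ≟ y
  ... | yes x≡y = x≡y
  ... | no  x≢y with toSimple (linked x∈⋃ y∈⋃ (reach-mono (λ _ → tt) (connected nB x y x∈B y∈B)))
  ...   | ε , _ = ⊥-elim (x≢y refl)
  ...   | w@(_◅_ {j = x₁} (x~x₁ , inC) w′) , simple with C , C∈Bs , x∈C , x₁∈C ← find inC =
    ⊥-elim (B∉Bs (subst (_∈ₗ Bs) (sym B≡C) C∈Bs))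
    where
    x₁∈B : x₁ ∈ B
    x₁∈B = maxB _ (p⊆p∪q _) (nonseparable-∪-walk proj₁ nB w simple x∈B y∈B)
                 (q⊆p∪q B _ (x∈p∪q⁺ (inj₂ (source∈vertices w′))))
    B≡C : B ≡ C
    B≡C = blocks-sharing-two-≡ bB (blocks C∈Bs) x∈B x∈C x₁∈B x₁∈C (Γ-irrefl x~x₁)

  Bridge : List (Subset k) → Subset k → Set
  Bridge Bs B = ∀ {x y} → x ∈⋃ Bs → y ∈ B → Reach G (λ _ → ⊤) x y → Star (BlockEdge (B ∷ Bs)) x y

  blockEdge-there : ∀ {B Bs} → BlockEdge Bs x y → BlockEdge (B ∷ Bs) x y
  blockEdge-there (x~y , inBs) = x~y , there inBs

  blockEdge-sym : ∀ {Bs} → BlockEdge Bs x y → BlockEdge Bs y x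
  blockEdge-sym (x~y , inBs) = Γ-sym x~y , Any.map swap inBs

  walk-inside : ∀ {B Bs} → Reach G (_∈ B) x y → Star (BlockEdge (B ∷ Bs)) x y
  walk-inside r = Star.map (λ (x∈ , x~y , y∈) → x~y , here (x∈ , y∈)) (reach⇒walk r)

  linked-∷ : ∀ {B Bs} → Nonseparable G B → Linked Bs → Bridge Bs B → Linked (B ∷ Bs)
  linked-∷ nB linked bridge (here x∈)  (here y∈)  _ = walk-inside (connected nB _ _ x∈ y∈)
  linked-∷ nB linked bridge (there x∈) (there y∈) r = Star.map blockEdge-there (linked x∈ y∈ r)
  linked-∷ nB linked bridge (there x∈) (here y∈)  r = bridge x∈ y∈ r
  linked-∷ nB linked bridge (here x∈)  (there y∈) r =
    Star.reverse blockEdge-sym (bridge y∈ x∈ (reach-sym r))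

  bridge-via : ∀ {B Bs z} → Nonseparable G B → Linked Bs → z ∈ B → z ∈⋃ Bs → Bridge Bs B
  bridge-via nB linked z∈B z∈⋃ x∈⋃ y∈B x→y =
    Star.map blockEdge-there (linked x∈⋃ z∈⋃ (x→y ++ʳ reach-mono (λ _ → tt) (connected nB _ _ y∈B z∈B)))
    ◅◅ walk-inside (connected nB _ _ z∈B y∈B)

  Meets : List (Subset k) → Subset k → Set
  Meets Bs D = ∃[ z ] z ∈ D × z ∈⋃ Bs

  meets? : ∀ Bs D → Dec (Meets Bs D)
  meets? Bs D = any? λ z → (z ∈? D) ×-dec Any.any? (z ∈?_) Bs

  BlockClosed : List (Subset k) → Set
  BlockClosed Bs = ∀ {D} → IsBlock G D → Meets Bs D → D ∈ₗ Bs

  reach-closed : ∀ {Bs} → BlockClosed Bs → x ∈⋃ Bs → Reach G (λ _ → ⊤) x y → y ∈⋃ Bs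
  reach-closed closed x∈ (here _) = x∈
  reach-closed closed x∈ (step _ x~x′ r) with D , bD , x∈D , x′∈D ← block-containing-edge x~x′ =
    reach-closed closed (Any.map (λ { refl → x′∈D }) (closed bD (_ , x∈D , x∈))) r

  bridge-closed : ∀ {B Bs} → Linked Bs → BlockClosed Bs → Bridge Bs B
  bridge-closed linked closed x∈⋃ y∈B x→y =
    Star.map blockEdge-there (linked x∈⋃ (reach-closed closed x∈⋃ x→y) x→y)

  record Stage (Bs Rs : List (Subset k)) : Set where
    field
      placed-blocks    : ∀ {B} → B ∈ₗ Bs → IsBlock G B
      remaining-blocks : ∀ {B} → B ∈ₗ Rs → IsBlock G B
      complete         : ∀ {B} → IsBlock G B → B ∈ₗ Bs ⊎ B ∈ₗ Rs
      fresh            : ∀ {B} → B ∈ₗ Rs → B ∉ₗ Bs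
      linked           : Linked Bs

  open Stage

  -- Prefer a block that meets the placed ones; if there is none, the placed blocks are closed
  -- under Γ-reachability and any block can go next.
  next : ∀ {Bs Rs R} → Stage Bs Rs → R ∈ₗ Rs → ∃[ B ] B ∈ₗ Rs × Bridge Bs B
  next {Bs} {Rs} {R} st R∈Rs with Any.any? (meets? Bs) Rs
  ... | yes meeting with B , B∈Rs , z , z∈B , z∈⋃ ← find meeting =
    B , B∈Rs , bridge-via (proj₁ (remaining-blocks st B∈Rs)) (linked st) z∈B z∈⋃
  ... | no  ¬meeting = R , R∈Rs , bridge-closed (linked st) closed
    where
    closed : BlockClosed Bs
    closed bD meets with complete st bD
    ... | inj₁ D∈Bs = D∈Bs
    ... | inj₂ D∈Rs = ⊥-elim (¬meeting (Any.map (λ { refl → meets }) D∈Rs))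

  _≟ˢ_ : (B C : Subset k) → Dec (B ≡ C)
  _≟ˢ_ = ≡-dec _≟ᵇ_

  other-than? : (B C : Subset k) → Dec (C ≢ B)
  other-than? B C = ¬? (C ≟ˢ B)

  without : Subset k → List (Subset k) → List (Subset k)
  without B = filter (other-than? B)

  ∈-without⁻ : ∀ {B C} Rs → C ∈ₗ without B Rs → C ∈ₗ Rs × C ≢ B
  ∈-without⁻ {B} Rs = ∈-filter⁻ (other-than? B) {xs = Rs}

  ∈-without⁺ : ∀ {B C Rs} → C ∈ₗ Rs → C ≢ B → C ∈ₗ without B Rs
  ∈-without⁺ {B} = ∈-filter⁺ (other-than? B)

  length-without : ∀ {B Rs} → B ∈ₗ Rs → suc (length (without B Rs)) ≤ length Rs
  length-without {B} {Rs} B∈Rs =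
    filter-notAll (other-than? B) Rs (Any.map (λ B≡C C≢B → C≢B (sym B≡C)) B∈Rs)

  place : ∀ {Bs Rs B} → Stage Bs Rs → B ∈ₗ Rs → Bridge Bs B → Stage (B ∷ Bs) (without B Rs)
  place {Bs} {Rs} {B} st B∈Rs bridge = record
    { placed-blocks    = λ { (here refl) → remaining-blocks st B∈Rs ; (there C∈Bs) → placed-blocks st C∈Bs }
    ; remaining-blocks = remaining-blocks st ∘ proj₁ ∘ ∈-without⁻ Rs
    ; complete         = complete′
    ; fresh            = fresh′
    ; linked           = linked-∷ (proj₁ (remaining-blocks st B∈Rs)) (linked st) bridge
    }
    where
    complete′ : ∀ {C} → IsBlock G C → C ∈ₗ B ∷ Bs ⊎ C ∈ₗ without B Rs
    complete′ {C} bC with complete st bC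
    ... | inj₁ C∈Bs = inj₁ (there C∈Bs)
    ... | inj₂ C∈Rs with C ≟ˢ B
    ...   | yes refl = inj₁ (here refl)
    ...   | no  C≢B  = inj₂ (∈-without⁺ C∈Rs C≢B)
    fresh′ : ∀ {C} → C ∈ₗ without B Rs → C ∉ₗ B ∷ Bs
    fresh′ C∈ (here C≡B)   = proj₂ (∈-without⁻ Rs C∈) C≡B
    fresh′ C∈ (there C∈Bs) = fresh st (proj₁ (∈-without⁻ Rs C∈)) C∈Bs

  record Ordering (Bs Rs : List (Subset k)) : Set where
    constructor arrangement
    field
      arranged         : List (Subset k)
      arranged⊆        : ∀ {C} → C ∈ₗ arranged → C ∈ₗ Rs
      ⊆arranged        : ∀ {C} → C ∈ₗ Rs → C ∈ₗ arranged
      arranged-unique  : Unique arranged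
      arranged-ordered : Ordered Bs arranged

  order : ∀ n {Bs Rs} → length Rs ≤ n → Stage Bs Rs → Ordering Bs Rs
  order _ {Rs = []} _ _ = arrangement [] (λ ()) (λ ()) [] tt
  order (suc n) {Bs} {Rs@(_ ∷ _)} |Rs|≤1+n st
    with B , B∈Rs , bridge ← next st (here refl)
    with arrangement Cs Cs⊆ ⊆Cs unique ordered
           ← order n (ℕ.≤-pred (≤-trans (length-without B∈Rs) |Rs|≤1+n)) (place st B∈Rs bridge) =
    arrangement (B ∷ Cs) sound complete′
      (All.tabulate (λ C∈Cs B≡C → proj₂ (∈-without⁻ Rs (Cs⊆ C∈Cs)) (sym B≡C)) ∷ unique)
      (fresh-block-meetsAtMostOnce (remaining-blocks st B∈Rs) (fresh st B∈Rs) (placed-blocks st) (linked st) ,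
       ordered)
    where
    sound : ∀ {C} → C ∈ₗ B ∷ Cs → C ∈ₗ Rs
    sound (here refl)  = B∈Rs
    sound (there C∈Cs) = proj₁ (∈-without⁻ Rs (Cs⊆ C∈Cs))
    complete′ : ∀ {C} → C ∈ₗ Rs → C ∈ₗ B ∷ Cs
    complete′ {C} C∈Rs with C ≟ˢ B
    ... | yes refl = here refl
    ... | no  C≢B  = there (⊆Cs (∈-without⁺ C∈Rs C≢B))

  blockList : List (Subset k)
  blockList = filter isBlock? (allSubsets k)

  -- Opaque so that unification never unfolds the (exponential) search over all subsets.
  opaque
    blockOrder : Ordering [] blockList
    blockOrder = order (length blockList) ℕ.≤-refl record
      { placed-blocks    = λ ()
      ; remaining-blocks = proj₂ ∘ ∈-filter⁻ isBlock? {xs = allSubsets k}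
      ; complete         = λ bB → inj₂ (∈-filter⁺ isBlock? (∈-allSubsets _) bB)
      ; fresh            = λ _ ()
      ; linked           = λ ()
      }

  PlacedBefore : List (Subset k) → (Cs : List (Subset k)) → Fin (length Cs) → Fin k → Set
  PlacedBefore Bs Cs i x = x ∈⋃ Bs ⊎ ∃[ j ] j < i × x ∈ List.lookup Cs j

  ordered-lookup : ∀ {Bs Cs} → Ordered Bs Cs → ∀ i {x y} →
                   x ∈ List.lookup Cs i → y ∈ List.lookup Cs i →
                   PlacedBefore Bs Cs i x → PlacedBefore Bs Cs i y → x ≡ y
  ordered-lookup {Bs} {C ∷ Cs} (once , _) Fin.zero x∈ y∈ x-before y-before =
    once x∈ y∈ (placed x-before) (placed y-before)
    where
    placed : PlacedBefore Bs (C ∷ Cs) Fin.zero z → z ∈⋃ Bs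
    placed (inj₁ z∈⋃) = z∈⋃
  ordered-lookup {Bs} {C ∷ Cs} (_ , ordered) (Fin.suc i) x∈ y∈ x-before y-before =
    ordered-lookup ordered i x∈ y∈ (shift x-before) (shift y-before)
    where
    shift : PlacedBefore Bs (C ∷ Cs) (Fin.suc i) z → PlacedBefore (C ∷ Bs) Cs i z
    shift (inj₁ z∈⋃)                         = inj₁ (there z∈⋃)
    shift (inj₂ (Fin.zero , _ , z∈C))         = inj₁ (here z∈C)
    shift (inj₂ (Fin.suc j , s≤s j<i , z∈Cⱼ)) = inj₂ (j , j<i , z∈Cⱼ)

  open Ordering blockOrder

  blockCount : ℕ
  blockCount = length arranged

  block : Fin blockCount → Subset k
  block = List.lookup arranged

  block-isBlock : ∀ i → IsBlock G (block i)
  block-isBlock i = proj₂ (∈-filter⁻ isBlock? {xs = allSubsets k} (arranged⊆ (∈-lookup i)))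

  block-injective : ∀ {i j} → block i ≡ block j → i ≡ j
  block-injective = lookup-injective arranged-unique _ _

  block-index : ∀ {B} → IsBlock G B → ∃[ i ] block i ≡ B
  block-index {B} bB = Any.index B∈ , sym (lookup-index B∈)
    where
    B∈ : B ∈ₗ arranged
    B∈ = ⊆arranged (∈-filter⁺ isBlock? (∈-allSubsets _) bB)

  Earlier : Fin blockCount → Fin k → Set
  Earlier i x = ∃[ j ] j < i × x ∈ block j

  earlier-unique : ∀ i → x ∈ block i → y ∈ block i → Earlier i x → Earlier i y → x ≡ y
  earlier-unique i x∈ y∈ x-earlier y-earlier =
    ordered-lookup arranged-ordered i x∈ y∈ (inj₂ x-earlier) (inj₂ y-earlier)

  color-in-block : ∀ c → ∃[ i ] c ∈ block i
  color-in-block c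
    with B , bB , c∈B ← block-containing c
    with i , refl ← block-index bB = i , c∈B

  edge-in-block : Γ x y → ∃[ i ] x ∈ block i × y ∈ block i
  edge-in-block x~y
    with B , bB , x∈B , y∈B ← block-containing-edge x~y
    with i , refl ← block-index bB = i , x∈B , y∈B

  GluedAlong : Fin blockCount → Fin k → Set
  GluedAlong i a = (∀ e → Earlier i (col e) × col e ∈ block i → col e ≡ a)
                 × (∀ e → col e ≡ a → Earlier i (col e) × col e ∈ block i)

  gluedAlong-shared : ∀ {i j a} → j < i → a ∈ block i → a ∈ block j → GluedAlong i a
  gluedAlong-shared {i} {j} j<i a∈i a∈j =
    (λ e (earlier , e∈i) → earlier-unique i e∈i a∈i earlier (j , j<i , a∈j)) ,
    λ { e refl → (j , j<i , a∈j) , a∈i }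

  glue-color : ∀ i → (∀ e → ¬ (Earlier i (col e) × col e ∈ block i))
                   ⊎ ∃[ a ] (IsArticulation G a × GluedAlong i a)
  glue-color i with any? (λ a → (a ∈? block i) ×-dec any? (λ j → (j Fin.<? i) ×-dec (a ∈? block j)))
  ... | no  none = inj₁ λ e (earlier , e∈i) → none (col e , e∈i , earlier)
  ... | yes (a , a∈i , j , j<i , a∈j) =
    inj₂ (a , shared⇒articulation (block-isBlock i) (block-isBlock j) a∈i a∈j
                (λ i≡j → Fin.<-irrefl (sym (block-injective i≡j)) j<i) ,
          gluedAlong-shared j<i a∈i a∈j)

  articulation-glued : ∀ {a} → IsArticulation G a → ∃[ i ] GluedAlong i a
  articulation-glued art
    with B₁ , B₂ , b₁ , b₂ , a∈₁ , a∈₂ , B₁≢B₂ ← articulation⇒shared art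
    with p , refl ← block-index b₁ | q , refl ← block-index b₂
    with Fin.<-cmp p q
  ... | tri< p<q _ _ = q , gluedAlong-shared p<q a∈₂ a∈₁
  ... | tri≈ _ refl _ = ⊥-elim (B₁≢B₂ refl)
  ... | tri> _ _ q<p = p , gluedAlong-shared q<p a∈₁ a∈₂

  -- The colors of adjacent edges lie in a common block l: l < i or l = i contradicts the
  -- hypotheses, and l > i would make block l meet earlier blocks in two colors.
  no-cross : ∀ i e f → Earlier i (col e) → col e ∉ block i → col f ∈ block i → ¬ Earlier i (col f) →
             ¬ HAdj G e f
  no-cross i e f (j , j<i , e∈j) e∉i f∈i f-new (_ , adjacent) with col e ≟ col f
  ... | yes same = f-new (j , j<i , subst (_∈ block j) same e∈j)
  ... | no differ with adjacent
  ...   | inj₂ same  = differ same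
  ...   | inj₁ share with edge-in-block (differ , e , f , refl , refl , share)
  ...     | l , e∈l , f∈l with Fin.<-cmp l i
  ...       | tri< l<i _ _ = f-new (l , l<i , f∈l)
  ...       | tri≈ _ refl _ = e∉i e∈l
  ...       | tri> _ _ i<l =
    differ (earlier-unique l e∈l f∈l (j , Fin.<-trans j<i i<l , e∈j) (i , i<l , f∈i))

mainTheorem4 : (G : EdgeColoredGraph) → CliqueSumDecomposition G
mainTheorem4 G = record
  { t          = blockCount
  ; blocks     = block
  ; distinct   = block-injective
  ; areBlocks  = block-isBlock
  ; allBlocks  = λ _ → block-index
  ; glueClique = λ i e f (e-earlier , e∈i) (f-earlier , f∈i) e≢f →
                   e≢f , inj₂ (earlier-unique i e∈i f∈i e-earlier f-earlier)
  ; noCross    = no-cross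
  ; glueColor  = glue-color
  ; artUsed    = λ _ → articulation-glued
  ; covers     = λ e → color-in-block (EdgeColoredGraph.col G e)
  }
  where open BlockTheory G
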